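{- Let $P$ be a well-typed program. If $\bar x:\bar T\vdash e:T$, $\sigma$ is a sensor state, $\bar\theta\in\mathrm{WFVT}(\bar x:\bar T\vdash e:T)$, $|\bar v|=|\bar x|$, $\emptyset\vdash\bar v:\bar T$, and $\sigma;\bar\theta\vdash e[\bar x:=\bar v]\Downarrow\theta$, then $\emptyset\vdash\rho(\theta):T$.
   Context: Types and values. There is a fixed set of ground types (e.g. real, bool); $[\![T]\!]$ is the set of values of type $T$, totally ordered by a noetherian order $\le_T$ (no infinite strictly ascending chain). For a finite non-empty set $V$ of values, $\min V$ is its $\le_T$-minimum. Syntax. Expressions: $e ::= x \mid s \mid v \mid e_0\,?\,e_1:e_2 \mid f(e_1,\dots,e_n) \mid \{e_0 : f(@,e_1,\dots,e_n)\}$ (variable, sensor name, ground value, conditional, function application, spreading expression). Each sensor $s$ has a type $\mathrm{type}(s)$, each ground value $v$ a type $\mathrm{type}(v)$. A function name $f$ is either built-in $b$ (with a fixed signature $T(T_1,\dots,T_n)$ and a total computable semantics $[\![b]\!]:[\![T_1]\!]\times\dots\times[\![T_n]\!]\to[\![T]\!]$) or user-defined $d$, defined by $\mathtt{def}\ T\ d(T_1\,x_1,\dots,T_n\,x_n)\ \mathtt{is}\ e$ (signature $T(T_1,\dots,T_n)$). A program is a finite map from user-defined names to their definitions such that every user-defined name used is defined and the call graph is acyclic (no recursion). A pure function is a built-in function or a user-defined function whose call graph (including itself) contains no spreading expression and no sensor. A diffusion is a pure function with signature $T(T_1,\dots,T_n)$, $n\ge1$, $T=T_1$. Typing. $\Gamma\vdash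 e:T$ with $\Gamma=x_1:T_1,\dots$: a variable has its assumed type; $s$ has $\mathrm{type}(s)$; $v$ has $\mathrm{type}(v)$; $e_0?e_1:e_2$ has $T$ if $e_0$ has bool and $e_1,e_2$ have $T$; $f(\bar e)$ has $T$ if $f$ has signature $T(\bar T)$ and $\bar e$ have types $\bar T$; $\{e_0:f(@,\bar e)\}$ has $T$ if $f$ is a diffusion and $f(e_0,\bar e)$ has $T$. A program is well-typed if each definition $\mathtt{def}\ T\ d(\bar T\,\bar x)\ \mathtt{is}\ e$ satisfies $\bar x:\bar T\vdash e:T$. A sensor state $\sigma$ maps each sensor $s$ to a value of type $\mathrm{type}(s)$. For lists, $\bar x:\bar T\vdash\bar e:\bar T$ means componentwise. Device semantics. Value-trees $\theta ::= v(\theta_1,\dots,\theta_n)$; $\rho(v(\bar\theta))=v$ and $\pi_i(v(\theta_1,\dots,\theta_n))=\theta_i$, both extended pointwise to lists of trees. Judgement $\sigma;\bar\theta\vdash e\Downarrow\theta$: $\sigma;\bar\theta\vdash s\Downarrow \sigma(s)()$; $\sigma;\bar\theta\vdash v\Downarrow v()$; for $e_1?e_2:e_3$: $\sigma;\pi_i(\bar\theta)\vdash e_i\Downarrow\eta_i$ ($i=1,2,3$), result $w(\eta_1,\eta_2,\eta_3)$ with $w=\rho(\eta_2)$ if $\rho(\eta_1)=$TRUE and $w=\rho(\eta_3)$ if FALSE; for $b(e_1,\dots,e_n)$: $\sigma;\pi_i(\bar\theta)\vdash e_i\Downarrow\eta_i$, result $[\![b]\!](\rho(\eta_1),\dots,\rho(\eta_n))(\eta_1,\dots,\eta_n)$;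 for $d(e_1,\dots,e_n)$ with body $e$ and parameters $x_1,\dots,x_n$: $\sigma;\pi_i(\bar\theta)\vdash e_i\Downarrow\theta'_i$, $\sigma;\pi_{n+1}(\bar\theta)\vdash e[x_1:=\rho(\theta'_1),\dots,x_n:=\rho(\theta'_n)]\Downarrow w(\bar\eta)$, result $w(\theta'_1,\dots,\theta'_n,w(\bar\eta))$; for $\{e_0:f(@,e_1,\dots,e_n)\}$: for $0\le i\le n$ evaluate $e_i$ against the list of the $(i+1)$-th subtrees of $\bar\theta$ obtaining $\eta_i$ with $v_i=\rho(\eta_i)$; let $u_1,\dots,u_m=\rho(\bar\theta)$; for each $j$, $\sigma;\emptyset\vdash f(u_j,v_1,\dots,v_n)\Downarrow r_j(\dots)$; result $(\min\{v_0,r_1,\dots,r_m\})(\eta_0,\dots,\eta_n)$. Well-typed value-trees. Given $\bar x:\bar T\vdash e:T$, the set $\mathrm{WFVT}(\bar x:\bar T\vdash e:T)$ is inductively defined: $\theta$ belongs to it if there exist a sensor state $\sigma$, a (possibly empty) list $\bar\theta$ of trees in $\mathrm{WFVT}(\bar x:\bar T\vdash e:T)$, and values $\bar v$ with $|\bar v|=|\bar x|$ and $\emptyset\vdash\bar v:\bar T$, such that $\sigma;\bar\theta\vdash e[\bar x:=\bar v]\Downarrow\theta$. $\bar\theta\in\mathrm{WFVT}(\dots)$ means each element belongs to it. -}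

module Defs where

open import Data.Nat using (ℕ; zero; suc; _≟_)
open import Data.Bool using (Bool; true; false)
open import Data.List using (List; []; _∷_; _++_; map; length)
open import Data.List.Relation.Unary.All using (All; []; _∷_)
open import Data.List.Relation.Unary.Any using (Any)
open import Data.List.Relation.Unary.AllPairs using (AllPairs)
open import Data.List.Relation.Binary.Pointwise using (Pointwise)
open import Data.List.Membership.Propositional using (_∈_)
open import Data.Maybe using (Maybe; just; nothing; maybe)
open import Data.Product using (Σ; ∃; _×_; _,_; proj₁; proj₂)
open import Data.Sum using (_⊎_)
open import Data.Unit using (⊤)
open import Relation.Nullary using (¬_; yes; no)
open import Relation.Binary.PropositionalEquality using (_≡_; _≢_)
open import Relation.Binary.Structures using (IsTotalOrder)
open import Relation.Binary.Construct.Closure.Transitive using (TransClosure)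
open import Relation.Binary.Construct.Closure.ReflexiveTransitive using (Star)

record Setup : Set₁ where
  field
    Ty      : Set
    ⟦_⟧     : Ty → Set
    _≤ᵀ_    : {T : Ty} → ⟦ T ⟧ → ⟦ T ⟧ → Set
    ≤-isTotalOrder : (T : Ty) → IsTotalOrder _≡_ (_≤ᵀ_ {T})
    noetherian : (T : Ty) →
      ¬ (Σ (ℕ → ⟦ T ⟧) λ f → (n : ℕ) → (f n ≤ᵀ f (suc n)) × (f n ≢ f (suc n)))
    bool    : Ty
    TRUE    : ⟦ bool ⟧
    FALSE   : ⟦ bool ⟧
    TRUE≢FALSE : TRUE ≢ FALSE
    bool-cases : (b : ⟦ bool ⟧) → (b ≡ TRUE) ⊎ (b ≡ FALSE)
    Sensor  : Set
    stype   : Sensor → Ty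
    Builtin : Set
    bret    : Builtin → Ty
    bargs   : Builtin → List Ty
    bsem    : (b : Builtin) → All ⟦_⟧ (bargs b) → ⟦ bret b ⟧

nth : {A : Set} → List A → ℕ → Maybe A
nth []       _       = nothing
nth (x ∷ xs) zero    = just x
nth (x ∷ xs) (suc i) = nth xs i

module Lang (S : Setup) where
  open Setup S

  -- a ground value: a type together with an element of its value set;
  -- type(v) = proj₁ v
  Value : Set
  Value = Σ Ty ⟦_⟧

  Name : Set
  Name = ℕ

  data Fun : Set where
    bi : Builtin → Fun
    ud : Name → Fun

  -- variables are de Bruijn-style positions: the parameters x₁ … xₙ of a
  -- context / definition are the variables 0 … n-1
  data Expr : Set where
    var    : ℕ → Expr
    sns    : Sensor → Expr
    val    : Value → Expr
    cond   : Expr → Expr → Expr → Expr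
    app    : Fun → List Expr → Expr
    spread : Expr → Fun → List Expr → Expr      -- { e₀ : f(@, e₁ … eₙ) }

  record Def : Set where
    constructor mkDef
    field
      ret    : Ty
      params : List Ty
      body   : Expr
  open Def public

  mutual
    subst : List Value → Expr → Expr
    subst vs (var i)          = maybe val (var i) (nth vs i)
    subst vs (sns s)          = sns s
    subst vs (val v)          = val v
    subst vs (cond e₀ e₁ e₂)  = cond (subst vs e₀) (subst vs e₁) (subst vs e₂)
    subst vs (app f es)       = app f (substs vs es)
    subst vs (spread e₀ f es) = spread (subst vs e₀) f (substs vs es)

    substs : List Value → List Expr → List Expr
    substs vs []       = []
    substs vs (e ∷ es) = subst vs e ∷ substs vs es

  data Uses : Expr → Name → Set where
    cond₀ : ∀ {e₀ e₁ e₂ d} → Uses e₀ d → Uses (cond e₀ e₁ e₂) d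
    cond₁ : ∀ {e₀ e₁ e₂ d} → Uses e₁ d → Uses (cond e₀ e₁ e₂) d
    cond₂ : ∀ {e₀ e₁ e₂ d} → Uses e₂ d → Uses (cond e₀ e₁ e₂) d
    appF  : ∀ {d es} → Uses (app (ud d) es) d
    appA  : ∀ {f es d} → Any (λ e → Uses e d) es → Uses (app f es) d
    sprF  : ∀ {e₀ d es} → Uses (spread e₀ (ud d) es) d
    spr₀  : ∀ {e₀ f es d} → Uses e₀ d → Uses (spread e₀ f es) d
    sprA  : ∀ {e₀ f es d} → Any (λ e → Uses e d) es → Uses (spread e₀ f es) d

  data NoSpreadSensor : Expr → Set where
    var  : ∀ {i} → NoSpreadSensor (var i)
    val  : ∀ {v} → NoSpreadSensor (val v)
    cond : ∀ {e₀ e₁ e₂} → NoSpreadSensor e₀ → NoSpreadSensor e₁ →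
           NoSpreadSensor e₂ → NoSpreadSensor (cond e₀ e₁ e₂)
    app  : ∀ {f es} → All NoSpreadSensor es → NoSpreadSensor (app f es)

  lookupDef : List (Name × Def) → Name → Maybe Def
  lookupDef []              d = nothing
  lookupDef ((d' , D) ∷ ds) d with d ≟ d'
  ... | yes _ = just D
  ... | no  _ = lookupDef ds d

  Calls : List (Name × Def) → Name → Name → Set
  Calls ds d d' = ∃ λ D → (lookupDef ds d ≡ just D) × Uses (body D) d'

  record Program : Set where
    field
      defs     : List (Name × Def)
      distinct : AllPairs (λ p q → proj₁ p ≢ proj₁ q) defs
      closed   : ∀ {d D d'} → (d , D) ∈ defs → Uses (body D) d' →
                 ∃ λ D' → lookupDef defs d' ≡ just D'
      acyclic  : ∀ d → ¬ TransClosure (Calls defs) d d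
  open Program public

  data VTree : Set where
    node : Value → List VTree → VTree

  ρ : VTree → Value
  ρ (node v _) = v

  -- π_i, 1-based; undefined (nothing) if the i-th subtree does not exist
  π : ℕ → VTree → Maybe VTree
  π zero    _             = nothing
  π (suc i) (node _ θs)   = nth θs i

  πs : ℕ → List VTree → Maybe (List VTree)
  πs i []       = just []
  πs i (θ ∷ θs) with π i θ | πs i θs
  ... | just η | just ηs = just (η ∷ ηs)
  ... | _      | _       = nothing

  SensorState : Set
  SensorState = (s : Sensor) → ⟦ stype s ⟧

  IsMin : Value → List Value → Set
  IsMin w V = w ∈ V × Σ Ty λ T → Σ ⟦ T ⟧ λ x → (w ≡ (T , x)) ×
              All (λ u → Σ ⟦ T ⟧ λ y → (u ≡ (T , y)) × (x ≤ᵀ y)) V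

  -- the list of typed values ρ(η₁) … ρ(ηₙ) seen as an element of ⟦T₁⟧ × … × ⟦Tₙ⟧
  data Args : (Ts : List Ty) → List Value → All ⟦_⟧ Ts → Set where
    []  : Args [] [] []
    _∷_ : ∀ {T Ts x vs xs} → Args Ts vs xs → Args (T ∷ Ts) ((T , x) ∷ vs) (x ∷ xs)

  module Sem (P : Program) where

    data HasSig : Fun → Ty → List Ty → Set where
      bi : ∀ b → HasSig (bi b) (bret b) (bargs b)
      ud : ∀ {d D} → lookupDef (defs P) d ≡ just D → HasSig (ud d) (ret D) (params D)

    Pure : Fun → Set
    Pure (bi b) = ⊤
    Pure (ud d) = ∀ d' → Star (Calls (defs P)) d d' →
                  ∃ λ D → (lookupDef (defs P) d' ≡ just D) × NoSpreadSensor (body D)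

    IsDiffusion : Fun → Set
    IsDiffusion f = Pure f × Σ Ty λ T → Σ (List Ty) λ Ts → HasSig f T (T ∷ Ts)

    -- typing  Γ ⊢ e ∶ T  (Γ = T₁ … Tₙ for variables 0 … n-1)
    infix 4 _⊢_∶_
    data _⊢_∶_ (Γ : List Ty) : Expr → Ty → Set where
      var    : ∀ {i T} → nth Γ i ≡ just T → Γ ⊢ var i ∶ T
      sns    : ∀ s → Γ ⊢ sns s ∶ stype s
      val    : ∀ T (x : ⟦ T ⟧) → Γ ⊢ val (T , x) ∶ T
      cond   : ∀ {e₀ e₁ e₂ T} → Γ ⊢ e₀ ∶ bool → Γ ⊢ e₁ ∶ T → Γ ⊢ e₂ ∶ T →
               Γ ⊢ cond e₀ e₁ e₂ ∶ T
      app    : ∀ {f es T Ts} → HasSig f T Ts →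
               Pointwise (λ e T' → Γ ⊢ e ∶ T') es Ts → Γ ⊢ app f es ∶ T
      spread : ∀ {e₀ f es T} → IsDiffusion f → Γ ⊢ app f (e₀ ∷ es) ∶ T →
               Γ ⊢ spread e₀ f es ∶ T

    WellTypedProgram : Set
    WellTypedProgram = ∀ {d D} → (d , D) ∈ defs P → params D ⊢ body D ∶ ret D

    -- device semantics  σ ; θ̄ ⊢ e ⇓ θ  and its list version:
    -- σ ; θ̄ ⊢* k , (e_k … e_{k+m}) ⇓ (η_k … η_{k+m}) evaluates e_i against π_i(θ̄)
    infix 3 _﹔_⊢_⇓_ _﹔_⊢*_,_⇓_
    mutual
      data _﹔_⊢_⇓_ (σ : SensorState) : List VTree → Expr → VTree → Set where
        e-sns  : ∀ {θs s} → σ ﹔ θs ⊢ sns s ⇓ node (stype s , σ s) []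
        e-val  : ∀ {θs v} → σ ﹔ θs ⊢ val v ⇓ node v []
        e-condT : ∀ {θs e₁ e₂ e₃ η₁ η₂ η₃} →
          σ ﹔ θs ⊢* 1 , (e₁ ∷ e₂ ∷ e₃ ∷ []) ⇓ (η₁ ∷ η₂ ∷ η₃ ∷ []) →
          ρ η₁ ≡ (bool , TRUE) →
          σ ﹔ θs ⊢ cond e₁ e₂ e₃ ⇓ node (ρ η₂) (η₁ ∷ η₂ ∷ η₃ ∷ [])
        e-condF : ∀ {θs e₁ e₂ e₃ η₁ η₂ η₃} →
          σ ﹔ θs ⊢* 1 , (e₁ ∷ e₂ ∷ e₃ ∷ []) ⇓ (η₁ ∷ η₂ ∷ η₃ ∷ []) →
          ρ η₁ ≡ (bool , FALSE) →
          σ ﹔ θs ⊢ cond e₁ e₂ e₃ ⇓ node (ρ η₃) (η₁ ∷ η₂ ∷ η₃ ∷ [])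
        e-bi : ∀ {θs b es ηs xs} →
          σ ﹔ θs ⊢* 1 , es ⇓ ηs →
          Args (bargs b) (map ρ ηs) xs →
          σ ﹔ θs ⊢ app (bi b) es ⇓ node (bret b , bsem b xs) ηs
        e-ud : ∀ {θs d D es θ's θsₙ w ηs} →
          lookupDef (defs P) d ≡ just D →
          σ ﹔ θs ⊢* 1 , es ⇓ θ's →
          πs (suc (length es)) θs ≡ just θsₙ →
          σ ﹔ θsₙ ⊢ subst (map ρ θ's) (body D) ⇓ node w ηs →
          σ ﹔ θs ⊢ app (ud d) es ⇓ node w (θ's ++ (node w ηs ∷ []))
        e-spread : ∀ {θs e₀ f es η₀ ηs rs w} →
          σ ﹔ θs ⊢* 1 , (e₀ ∷ es) ⇓ (η₀ ∷ ηs) →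
          Pointwise (λ u r → σ ﹔ [] ⊢ app f (val u ∷ map val (map ρ ηs)) ⇓ r)
                    (map ρ θs) rs →
          IsMin w (ρ η₀ ∷ map ρ rs) →
          σ ﹔ θs ⊢ spread e₀ f es ⇓ node w (η₀ ∷ ηs)

      data _﹔_⊢*_,_⇓_ (σ : SensorState) : List VTree → ℕ → List Expr → List VTree → Set where
        []  : ∀ {θs k} → σ ﹔ θs ⊢* k , [] ⇓ []
        _∷_ : ∀ {θs k θsₖ e es η ηs} →
          (πs k θs ≡ just θsₖ) × (σ ﹔ θsₖ ⊢ e ⇓ η) →
          σ ﹔ θs ⊢* suc k , es ⇓ ηs →
          σ ﹔ θs ⊢* k , (e ∷ es) ⇓ (η ∷ ηs)

    data WFVT (Ts : List Ty) (e : Expr) (T : Ty) : VTree → Set where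
      wfvt : ∀ {θ} (σ : SensorState) (θs : List VTree) → All (WFVT Ts e T) θs →
             (vs : List Value) → length vs ≡ length Ts →
             Pointwise (λ v T' → [] ⊢ val v ∶ T') vs Ts →
             σ ﹔ θs ⊢ subst vs e ⇓ θ → WFVT Ts e T θ

module Submission where

open import Defs
open import Data.Nat using (zero; suc; _≟_)
open import Data.List using (List; []; _∷_; length; map)
open import Data.List.Relation.Unary.All using (All; _∷_)
open import Data.List.Relation.Unary.Any using (here; there)
open import Data.List.Relation.Binary.Pointwise using (Pointwise; []; _∷_)
open import Data.List.Membership.Propositional using (_∈_)
open import Data.Maybe using (just)
open import Data.Product using (∃; _×_; _,_; proj₁)
open import Relation.Nullary using (yes; no)
open import Relation.Binary.PropositionalEquality using (_≡_; refl; sym; trans; cong)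

-- The root of a call to d is the root
-- of its body, which is typed because P is well-typed; the root of a
-- spreading expression is a minimum over values of the type of its
-- initial value e₀, which is the return type since f is a diffusion.
-- Neither the neighbours' trees nor their well-formedness play any role.

Pointwise-nth : ∀ {r} {A B : Set} {R : A → B → Set r}
                {xs ys} i {y} → Pointwise R xs ys → nth ys i ≡ just y →
                ∃ λ x → nth xs i ≡ just x × R x y
Pointwise-nth zero    (r ∷ _)  refl = _ , refl , r
Pointwise-nth (suc i) (_ ∷ rs) eq   = Pointwise-nth i rs eq

module _ (S : Setup) where
  open Setup S
  open Lang S

  lookupDef-∈ : ∀ ds {d D} → lookupDef ds d ≡ just D → (d , D) ∈ ds
  lookupDef-∈ ((d' , D') ∷ ds) {d} eq with d ≟ d'
  lookupDef-∈ ((d' , D') ∷ ds) refl | yes refl = here refl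
  ... | no _ = there (lookupDef-∈ ds eq)

  IsMin-type : ∀ {w u us} → IsMin w (u ∷ us) → proj₁ w ≡ proj₁ u
  IsMin-type (_ , _ , _ , refl , (_ , refl , _) ∷ _) = refl

  module _ (P : Program) where
    open Sem P

    ⊢val-type : ∀ {Γ v T} → Γ ⊢ val v ∶ T → proj₁ v ≡ T
    ⊢val-type (val T x) = refl

    ⊢val : ∀ {Γ} v {T} → proj₁ v ≡ T → Γ ⊢ val v ∶ T
    ⊢val (T , x) refl = val T x

    HasSig-unique : ∀ {f T Ts T' Ts'} → HasSig f T Ts → HasSig f T' Ts' →
                    T ≡ T' × Ts ≡ Ts'
    HasSig-unique (bi b) (bi .b) = refl , refl
    HasSig-unique (ud l) (ud l') with trans (sym l) l'
    ... | refl = refl , refl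

    ClosedTyped : List Value → List Ty → Set
    ClosedTyped vs Γ = Pointwise (λ v T → [] ⊢ val v ∶ T) vs Γ

    mutual
      subst-⊢ : ∀ {Γ Δ vs e T} → ClosedTyped vs Γ → Γ ⊢ e ∶ T → Δ ⊢ subst vs e ∶ T
      subst-⊢ vs∶Γ (var {i = i} eq) with Pointwise-nth i vs∶Γ eq
      ... | v , vᵢ , v∶T rewrite vᵢ = ⊢val v (⊢val-type v∶T)
      subst-⊢ vs∶Γ (sns s)                       = sns s
      subst-⊢ vs∶Γ (val T x)                     = val T x
      subst-⊢ vs∶Γ (cond t₀ t₁ t₂)               =
        cond (subst-⊢ vs∶Γ t₀) (subst-⊢ vs∶Γ t₁) (subst-⊢ vs∶Γ t₂)
      subst-⊢ vs∶Γ (app f∶ ts)                   = app f∶ (substs-⊢ vs∶Γ ts)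
      subst-⊢ vs∶Γ (spread diff (app f∶ ts))     = spread diff (app f∶ (substs-⊢ vs∶Γ ts))

      substs-⊢ : ∀ {Γ Δ vs es Ts} → ClosedTyped vs Γ →
                 Pointwise (λ e T → Γ ⊢ e ∶ T) es Ts →
                 Pointwise (λ e T → Δ ⊢ e ∶ T) (substs vs es) Ts
      substs-⊢ vs∶Γ []       = []
      substs-⊢ vs∶Γ (t ∷ ts) = subst-⊢ vs∶Γ t ∷ substs-⊢ vs∶Γ ts

    module _ (wt : WellTypedProgram) where

      mutual
        ⇓-type : ∀ {σ θs e θ T} → [] ⊢ e ∶ T → σ ﹔ θs ⊢ e ⇓ θ → proj₁ (ρ θ) ≡ T
        ⇓-type (sns s)   e-sns = refl
        ⇓-type (val T x) e-val = refl
        ⇓-type (cond _ t₁ _) (e-condT (_ ∷ (_ , ev₁) ∷ _ ∷ []) _) = ⇓-type t₁ ev₁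
        ⇓-type (cond _ _ t₂) (e-condF (_ ∷ _ ∷ (_ , ev₂) ∷ []) _) = ⇓-type t₂ ev₂
        ⇓-type (app (bi b) _) (e-bi _ _) = refl
        ⇓-type (app (ud l') ts) (e-ud l evs _ ev-body) with trans (sym l) l'
        ... | refl = ⇓-type (subst-⊢ (⇓*-closedTyped ts evs) (wt (lookupDef-∈ (defs P) l)))
                            ev-body
        ⇓-type (spread (_ , _ , _ , f∶) (app f∶' (t₀ ∷ _))) (e-spread ((_ , ev₀) ∷ _) _ min)
          with HasSig-unique f∶ f∶'
        ... | refl , refl = trans (IsMin-type min) (⇓-type t₀ ev₀)

        ⇓*-closedTyped : ∀ {σ θs k es ηs Ts} → Pointwise (λ e T → [] ⊢ e ∶ T) es Ts →
                         σ ﹔ θs ⊢* k , es ⇓ ηs → ClosedTyped (map ρ ηs) Ts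
        ⇓*-closedTyped []       []              = []
        ⇓*-closedTyped (t ∷ ts) ((_ , ev) ∷ evs) =
          ⊢val _ (⇓-type t ev) ∷ ⇓*-closedTyped ts evs

theorem5p1 : (S : Setup) → let open Setup S in let open Lang S in
    (P : Program) → let open Sem P in
    WellTypedProgram →
    (Ts : List Ty) (e : Expr) (T : Ty) → Ts ⊢ e ∶ T →
    (σ : SensorState) (θs : List VTree) → All (WFVT Ts e T) θs →
    (vs : List Value) → length vs ≡ length Ts →
    Pointwise (λ v T' → [] ⊢ val v ∶ T') vs Ts →
    (θ : VTree) → σ ﹔ θs ⊢ subst vs e ⇓ θ →
    [] ⊢ val (ρ θ) ∶ T
theorem5p1 S P wt Ts e T e∶T σ θs _ vs _ vs∶Ts θ ev =
  ⊢val S P (Lang.ρ S θ) (⇓-type S P wt (subst-⊢ S P vs∶Ts e∶T) ev)
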